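{- Let $l$, $k$, $r$, $q$ be positive integers with $r\le k$. Suppose that $q$ divides $l^{k-r}$ and $l$ does not divide $q$. Suppose further that one of the following holds: (a) $r\ge k/2$; (b) $r<k/2$ and $l^{k-2r}$ divides $q^2$. Let $\varepsilon\in\{1,-1\}$. If $m$ is an integer with $\gcd(m,\,l^{k-r}/q)=1$, then $$S(\varepsilon+l^r q m,\ l^k)=\varepsilon\left(\frac{2}{l^k}+l^{2r-k}q^2-3\right).$$
   Context: For a positive integer $n$ and an integer $m$ with $\gcd(m,n)=1$, the Dedekind sum is $s(m,n)=\sum_{k=1}^{n}((k/n))((mk/n))$, where $((t))=t-\lfloor t\rfloor-1/2$ if $t\in\mathbb{R}\setminus\mathbb{Z}$ and $((t))=0$ if $t\in\mathbb{Z}$. The normalized Dedekind sum is $S(m,n)=12\,s(m,n)$. -}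

module Defs where

open import Data.Nat as ℕ using (ℕ; zero; suc)
open import Data.Integer as ℤ using (ℤ; +_)
open import Data.Rational as ℚ using (ℚ; 0ℚ; ½; floor; _-_; _*_; _+_)
open import Data.Bool using (if_then_else_)
open import Relation.Nullary using (does)

-- The integer a viewed as the rational a/n (n positive); a/0 is defined as 0
-- (never used: all denominators in the statement are positive).
_//_ : ℤ → ℕ → ℚ
a // zero = 0ℚ
a // suc n = a ℚ./ suc n

saw : ℚ → ℚ
saw t = if does (t ℚ.≟ (floor t ℚ./ 1)) then 0ℚ else (t - (floor t ℚ./ 1) - ½)

sum1 : ℕ → (ℕ → ℚ) → ℚ
sum1 zero f = 0ℚ
sum1 (suc N) f = sum1 N f + f (suc N)

s : ℤ → ℕ → ℚ
s m n = sum1 n (λ k → saw ((+ k) // n) * saw ((m ℤ.* + k) // n))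

S : ℤ → ℕ → ℚ
S m n = ((+ 12) // 1) * s m n

-- Write N = l^k = a d with a = l^r q and d = l^(k-r) / q; hypotheses (a) and (b) say exactly that
-- d divides a, say a = c d, so N = c d^2.  With w x = 2N ((x/N)), an integer, 12 s(h, N) is
-- 3 (Σ_{k<N} w(k) w(hk)) / N^2.  For h = 1 + a m and k = j d + t (j < a, t < d) one has
-- h k ≡ (j + c u_t) d + t (mod N) with u_t = m t mod d: multiplication by h rotates the residue
-- class of t modulo d by c u_t steps.  On a class with t ≠ 0, w(j d + t) is affine in j, and the
-- cyclic autocorrelation of an affine sequence is its sum of squares minus an explicit term depending
-- only on the rotation.  As gcd(m, d) = 1, t ↦ u_t permutes {0, …, d-1}, so these terms add up as if
-- u_t = t, and everything reduces to Σ k^2 and Σ t (d - t).  The case ε = -1 follows from w(-x) = -w(x).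

module Submission where

open import Data.Nat as ℕ using (ℕ; zero; suc; _<_; _≤_; _∸_; _^_; NonZero)
import Data.Nat.Properties as ℕP
open import Data.Nat.Divisibility using (_∣_; divides)
open import Data.Nat.GCD using (gcd; module Bézout)
open import Data.Nat.Coprimality using (gcd≡1⇒coprime; coprime-Bézout)
import Data.Nat.Tactic.RingSolver as NS
open import Data.Integer as ℤ using (ℤ; +_; -_; -[1+_]; _+_; _*_; _-_; 0ℤ; ∣_∣; _⊖_)
import Data.Integer.Properties as ℤP
open import Data.Integer.DivMod using (_%ℕ_; _/ℕ_; a≡a%ℕn+[a/ℕn]*n; n%ℕd<d; div-pos-is-/ℕ)
open import Data.Integer.Tactic.RingSolver using (solve-∀)
open import Data.Rational as ℚ using (ℚ; mkℚ; 0ℚ; ½)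
open import Data.Rational.Unnormalised using (mkℚᵘ; *≡*)
import Data.Rational.Unnormalised.Properties as ℚᵘP
open import Data.Rational.Properties as ℚP using (fromℚᵘ-cong; fromℚᵘ-toℚᵘ; toℚᵘ-fromℚᵘ; fromℚᵘ-injective)
open import Data.Fin as Fin using (Fin; toℕ)
import Data.Fin.Properties as FinP
open import Data.Fin.Permutation using (permutation)
open import Data.Product using (_×_; _,_; proj₁; proj₂; ∃₂)
open import Data.Sum using (_⊎_; inj₁; inj₂)
open import Data.Empty using (⊥-elim)
open import Data.Bool using (if_then_else_)
open import Function using (_∘_)
open import Relation.Nullary using (¬_; yes; no; does)
open import Relation.Binary.PropositionalEquality
open import Algebra.Properties.Semiring.Sum ℤP.+-*-semiring
  using (sum; sum-cong-≗; ∑-distrib-+; ∑-comm; *-distribˡ-sum; sum-permute)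
open import Algebra.Properties.AbelianGroup ℤP.+-0-abelianGroup using (∙-cancelˡ; ∙-cancelʳ)
open import Defs

∑< : ℕ → (ℕ → ℤ) → ℤ
∑< n f = sum {n} (f ∘ toℕ)

∑<-cong : ∀ n {f g : ℕ → ℤ} → (∀ i → i < n → f i ≡ g i) → ∑< n f ≡ ∑< n g
∑<-cong n f≗g = sum-cong-≗ (λ i → f≗g (toℕ i) (FinP.toℕ<n i))

∑<-distrib-+ : ∀ n (f g : ℕ → ℤ) → ∑< n (λ i → f i + g i) ≡ ∑< n f + ∑< n g
∑<-distrib-+ n f g = ∑-distrib-+ {n} (f ∘ toℕ) (g ∘ toℕ)

*-distribˡ-∑< : ∀ n (x : ℤ) (f : ℕ → ℤ) → x * ∑< n f ≡ ∑< n (λ i → x * f i)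
*-distribˡ-∑< n x f = *-distribˡ-sum {n} x (f ∘ toℕ)

∑<-neg : ∀ n (f : ℕ → ℤ) → ∑< n (λ i → - f i) ≡ - ∑< n f
∑<-neg n f = begin
  ∑< n (λ i → - f i)          ≡⟨ ∑<-cong n (λ i _ → sym (ℤP.-1*i≡-i (f i))) ⟩
  ∑< n (λ i → - + 1 * f i)    ≡⟨ *-distribˡ-∑< n (- + 1) f ⟨
  - + 1 * ∑< n f              ≡⟨ ℤP.-1*i≡-i (∑< n f) ⟩
  - ∑< n f                    ∎
  where open ≡-Reasoning

∑<-distrib-- : ∀ n (f g : ℕ → ℤ) → ∑< n (λ i → f i - g i) ≡ ∑< n f - ∑< n g
∑<-distrib-- n f g = trans (∑<-distrib-+ n f (λ i → - g i)) (cong (_+_ (∑< n f)) (∑<-neg n g))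

∑<-comm : ∀ m n (f : ℕ → ℕ → ℤ) → ∑< m (λ i → ∑< n (f i)) ≡ ∑< n (λ j → ∑< m (λ i → f i j))
∑<-comm m n f = ∑-comm {m} {n} (λ i j → f (toℕ i) (toℕ j))

∑<-head : ∀ n .{{_ : NonZero n}} (f : ℕ → ℤ) → ∑< n f ≡ f 0 + ∑< (ℕ.pred n) (f ∘ suc)
∑<-head (suc n) f = refl

∑<-snoc : ∀ n (f : ℕ → ℤ) → ∑< (suc n) f ≡ ∑< n f + f n
∑<-snoc zero    f = trans (ℤP.+-identityʳ (f 0)) (sym (ℤP.+-identityˡ (f 0)))
∑<-snoc (suc n) f = trans (cong (_+_ (f 0)) (∑<-snoc n (f ∘ suc))) (sym (ℤP.+-assoc (f 0) _ _))

∑<-+ : ∀ m n (f : ℕ → ℤ) → ∑< (m ℕ.+ n) f ≡ ∑< m f + ∑< n (λ i → f (m ℕ.+ i))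
∑<-+ zero    n f = sym (ℤP.+-identityˡ _)
∑<-+ (suc m) n f = trans (cong (_+_ (f 0)) (∑<-+ m n (f ∘ suc))) (sym (ℤP.+-assoc (f 0) _ _))

∑<-* : ∀ a d (f : ℕ → ℤ) → ∑< (a ℕ.* d) f ≡ ∑< a (λ j → ∑< d (λ t → f (j ℕ.* d ℕ.+ t)))
∑<-* zero    d f = refl
∑<-* (suc a) d f = trans (∑<-+ d (a ℕ.* d) f) (cong (_+_ (∑< d f)) (trans (∑<-* a d (λ i → f (d ℕ.+ i)))
  (∑<-cong a (λ j _ → ∑<-cong d (λ t _ → cong f (sym (ℕP.+-assoc d (j ℕ.* d) t)))))))

∑<-rotate : ∀ n (f : ℕ → ℤ) → f 0 ≡ f n → ∑< n (f ∘ suc) ≡ ∑< n f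
∑<-rotate n f f0≡fn = ∙-cancelˡ (f 0) _ _ (begin
  f 0 + ∑< n (f ∘ suc) ≡⟨ ∑<-snoc n f ⟩
  ∑< n f + f n         ≡⟨ cong (_+_ (∑< n f)) (sym f0≡fn) ⟩
  ∑< n f + f 0         ≡⟨ ℤP.+-comm (∑< n f) (f 0) ⟩
  f 0 + ∑< n f         ∎)
  where open ≡-Reasoning

∑<-reindex : ∀ n (π σ : ℕ → ℕ) →
  (∀ i → i < n → π i < n) → (∀ i → i < n → σ i < n) →
  (∀ i → i < n → π (σ i) ≡ i) → (∀ i → i < n → σ (π i) ≡ i) →
  ∀ (f : ℕ → ℤ) → ∑< n (f ∘ π) ≡ ∑< n f
∑<-reindex n π σ π< σ< πσ σπ f = begin
  ∑< n (f ∘ π)                  ≡⟨ sum-cong-≗ (λ i → cong f (sym (FinP.toℕ-fromℕ< (π< _ (FinP.toℕ<n i))))) ⟩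
  sum (f ∘ toℕ ∘ lift π π<)     ≡⟨ sum-permute (f ∘ toℕ) perm ⟨
  ∑< n f                        ∎
  where
  open ≡-Reasoning
  lift : (ρ : ℕ → ℕ) → (∀ i → i < n → ρ i < n) → Fin n → Fin n
  lift ρ ρ< i = Fin.fromℕ< (ρ< (toℕ i) (FinP.toℕ<n i))
  inverse : ∀ {ρ τ} ρ< τ< → (∀ i → i < n → ρ (τ i) ≡ i) → ∀ i → lift ρ ρ< (lift τ τ< i) ≡ i
  inverse {ρ} {τ} ρ< τ< ρτ i = FinP.toℕ-injective (begin
    toℕ (lift ρ ρ< (lift τ τ< i)) ≡⟨ FinP.toℕ-fromℕ< _ ⟩
    ρ (toℕ (lift τ τ< i))         ≡⟨ cong ρ (FinP.toℕ-fromℕ< _) ⟩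
    ρ (τ (toℕ i))                 ≡⟨ ρτ (toℕ i) (FinP.toℕ<n i) ⟩
    toℕ i                         ∎)
  perm = permutation (lift π π<) (lift σ σ<) (inverse π< σ< πσ) (inverse σ< π< σπ)

faulhaber₂ : ℤ → ℤ → ℤ → ℤ → ℤ
faulhaber₂ n p q r = p * n * (n - + 1) * (+ 2 * n - + 1) + + 3 * q * n * (n - + 1) + + 6 * r * n

∑<-quadratic : ∀ n (p q r : ℤ) {f : ℕ → ℤ} → (∀ t → f t ≡ p * + t * + t + q * + t + r) →
  + 6 * ∑< n f ≡ faulhaber₂ (+ n) p q r
∑<-quadratic n p q r {f} f≡ = trans (cong (+ 6 *_) (∑<-cong n (λ t _ → f≡ t))) (closed n)
  where
  g = λ (t : ℕ) → p * + t * + t + q * + t + r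
  base : ∀ p q r → 0ℤ ≡ p * + 0 * (+ 0 - + 1) * (+ 2 * + 0 - + 1) + + 3 * q * + 0 * (+ 0 - + 1) + + 6 * r * + 0
  base = solve-∀
  step : ∀ (n p q r : ℤ) →
    p * n * (n - + 1) * (+ 2 * n - + 1) + + 3 * q * n * (n - + 1) + + 6 * r * n + + 6 * (p * n * n + q * n + r)
    ≡ p * (+ 1 + n) * ((+ 1 + n) - + 1) * (+ 2 * (+ 1 + n) - + 1) + + 3 * q * (+ 1 + n) * ((+ 1 + n) - + 1) + + 6 * r * (+ 1 + n)
  step = solve-∀
  closed : ∀ n → + 6 * ∑< n g ≡ faulhaber₂ (+ n) p q r
  closed zero    = base p q r
  closed (suc n) = begin
    + 6 * ∑< (suc n) g           ≡⟨ cong (+ 6 *_) (∑<-snoc n g) ⟩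
    + 6 * (∑< n g + g n)         ≡⟨ ℤP.*-distribˡ-+ (+ 6) (∑< n g) (g n) ⟩
    + 6 * ∑< n g + + 6 * g n     ≡⟨ cong (_+ + 6 * g n) (closed n) ⟩
    _                            ≡⟨ step (+ n) p q r ⟩
    faulhaber₂ (+ suc n) p q r   ∎
    where open ≡-Reasoning

∑<-[2k-n]² : ∀ n → + 3 * ∑< n (λ k → (+ 2 * + k - + n) * (+ 2 * + k - + n)) ≡ + n * + n * + n + + 2 * + n
∑<-[2k-n]² n = ℤP.*-cancelˡ-≡ (+ 2) _ _ (begin
  + 2 * (+ 3 * ∑< n f)                ≡⟨ ℤP.*-assoc (+ 2) (+ 3) (∑< n f) ⟨
  + 6 * ∑< n f                        ≡⟨ ∑<-quadratic n (+ 4) (- (+ 4 * + n)) (+ n * + n) (λ k → expand (+ k) (+ n)) ⟩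
  faulhaber₂ (+ n) (+ 4) (- (+ 4 * + n)) (+ n * + n) ≡⟨ closed (+ n) ⟩
  + 2 * (+ n * + n * + n + + 2 * + n) ∎)
  where
  open ≡-Reasoning
  f = λ (k : ℕ) → (+ 2 * + k - + n) * (+ 2 * + k - + n)
  expand : ∀ k n → (+ 2 * k - n) * (+ 2 * k - n) ≡ + 4 * k * k + - (+ 4 * n) * k + n * n
  expand = solve-∀
  closed : ∀ n → + 4 * n * (n - + 1) * (+ 2 * n - + 1) + + 3 * - (+ 4 * n) * n * (n - + 1) + + 6 * (n * n) * n
                 ≡ + 2 * (n * n * n + + 2 * n)
  closed = solve-∀

∑<-k[n-k] : ∀ n → + 6 * ∑< n (λ k → + k * (+ n - + k)) ≡ + n * + n * + n - + n
∑<-k[n-k] n = trans (∑<-quadratic n (- + 1) (+ n) 0ℤ (λ k → expand (+ k) (+ n))) (closed (+ n))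
  where
  expand : ∀ k n → k * (n - k) ≡ - + 1 * k * k + n * k + 0ℤ
  expand = solve-∀
  closed : ∀ n → - + 1 * n * (n - + 1) * (+ 2 * n - + 1) + + 3 * n * n * (n - + 1) + + 6 * 0ℤ * n ≡ n * n * n - n
  closed = solve-∀

-- The left side is Σ_{j < x+s} L j · L ((j + s) mod (x + s)), split where the index wraps around.
∑<-linear-autocorrelation : ∀ (α β : ℤ) x s → let L = λ (j : ℕ) → α * + j + β in
  + 2 * (∑< x (λ j → L j * L (j ℕ.+ s)) + ∑< s (λ i → L (x ℕ.+ i) * L i))
  ≡ + 2 * ∑< (x ℕ.+ s) (λ j → L j * L j) - α * α * + (x ℕ.+ s) * + s * + x
∑<-linear-autocorrelation α β x s = ℤP.*-cancelˡ-≡ (+ 3) _ _ (begin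
  + 3 * (+ 2 * (∑< x shifted + ∑< s wrapped))
    ≡⟨ regroup₁ (∑< x shifted) (∑< s wrapped) ⟩
  + 6 * ∑< x shifted + + 6 * ∑< s wrapped
    ≡⟨ cong₂ _+_ (∑<-quadratic x (α * α) q₁ r₁ shifted≡) (∑<-quadratic s (α * α) q₂ r₂ wrapped≡) ⟩
  faulhaber₂ X̂ (α * α) q₁ r₁ + faulhaber₂ Ŝ (α * α) q₂ r₂
    ≡⟨ key α β X̂ Ŝ ⟩
  faulhaber₂ (X̂ + Ŝ) (α * α) (+ 2 * α * β) (β * β) - + 3 * loss (X̂ + Ŝ)
    ≡⟨ cong (λ y → faulhaber₂ y (α * α) (+ 2 * α * β) (β * β) - + 3 * loss y) (ℤP.pos-+ x s) ⟨
  faulhaber₂ (+ (x ℕ.+ s)) (α * α) (+ 2 * α * β) (β * β) - + 3 * loss (+ (x ℕ.+ s))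
    ≡⟨ cong (_- + 3 * loss (+ (x ℕ.+ s))) (∑<-quadratic (x ℕ.+ s) (α * α) (+ 2 * α * β) (β * β) square≡) ⟨
  + 6 * ∑< (x ℕ.+ s) square - + 3 * loss (+ (x ℕ.+ s))
    ≡⟨ regroup₂ (∑< (x ℕ.+ s) square) (loss (+ (x ℕ.+ s))) ⟩
  + 3 * (+ 2 * ∑< (x ℕ.+ s) square - loss (+ (x ℕ.+ s))) ∎)
  where
  open ≡-Reasoning
  X̂ = + x
  Ŝ = + s
  L = λ (j : ℕ) → α * + j + β
  shifted = λ j → L j * L (j ℕ.+ s)
  wrapped = λ i → L (x ℕ.+ i) * L i
  square = λ j → L j * L j
  q₁ = α * (α * Ŝ + β) + α * β
  r₁ = β * (α * Ŝ + β)
  q₂ = α * β + α * (α * X̂ + β)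
  r₂ = (α * X̂ + β) * β
  loss : ℤ → ℤ
  loss n = α * α * n * Ŝ * X̂
  e₁ : ∀ α β J S → (α * J + β) * (α * (J + S) + β) ≡ α * α * J * J + (α * (α * S + β) + α * β) * J + β * (α * S + β)
  e₁ = solve-∀
  shifted≡ : ∀ j → shifted j ≡ α * α * + j * + j + q₁ * + j + r₁
  shifted≡ j = trans (cong (λ y → L j * (α * y + β)) (ℤP.pos-+ j s)) (e₁ α β (+ j) Ŝ)
  e₂ : ∀ α β X I → (α * (X + I) + β) * (α * I + β) ≡ α * α * I * I + (α * β + α * (α * X + β)) * I + (α * X + β) * β
  e₂ = solve-∀
  wrapped≡ : ∀ i → wrapped i ≡ α * α * + i * + i + q₂ * + i + r₂
  wrapped≡ i = trans (cong (λ y → (α * y + β) * L i) (ℤP.pos-+ x i)) (e₂ α β X̂ (+ i))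
  e₃ : ∀ α β J → (α * J + β) * (α * J + β) ≡ α * α * J * J + + 2 * α * β * J + β * β
  e₃ = solve-∀
  square≡ : ∀ j → square j ≡ α * α * + j * + j + + 2 * α * β * + j + β * β
  square≡ j = e₃ α β (+ j)
  regroup₁ : ∀ a b → + 3 * (+ 2 * (a + b)) ≡ + 6 * a + + 6 * b
  regroup₁ = solve-∀
  regroup₂ : ∀ a b → + 6 * a - + 3 * b ≡ + 3 * (+ 2 * a - b)
  regroup₂ = solve-∀
  key : ∀ α β X S →
      (α * α * X * (X - + 1) * (+ 2 * X - + 1) + + 3 * (α * (α * S + β) + α * β) * X * (X - + 1)
        + + 6 * (β * (α * S + β)) * X)
    + (α * α * S * (S - + 1) * (+ 2 * S - + 1) + + 3 * (α * β + α * (α * X + β)) * S * (S - + 1)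
        + + 6 * ((α * X + β) * β) * S)
    ≡ α * α * (X + S) * ((X + S) - + 1) * (+ 2 * (X + S) - + 1) + + 3 * (+ 2 * α * β) * (X + S) * ((X + S) - + 1)
      + + 6 * (β * β) * (X + S) - + 3 * (α * α * (X + S) * S * X)
  key = solve-∀

pos-*-+ : ∀ j d t → + (j ℕ.* d ℕ.+ t) ≡ + j * + d + + t
pos-*-+ j d t = trans (ℤP.pos-+ (j ℕ.* d) t) (cong (_+ + t) (ℤP.pos-* j d))

divMod-unique : ∀ {d r r′} .{{_ : NonZero d}} (q q′ : ℤ) → r < d → r′ < d →
  + r + q * + d ≡ + r′ + q′ * + d → r ≡ r′ × q ≡ q′
divMod-unique {d} {r} {r′} q q′ r<d r′<d eq = r≡r′ , q≡q′
  where
  [q-q′]*d≡r′⊖r : (q - q′) * + d ≡ r′ ⊖ r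
  [q-q′]*d≡r′⊖r = begin
    (q - q′) * + d                          ≡⟨ solve₁ q q′ (+ r) (+ d) ⟩
    (+ r + q * + d) - (+ r + q′ * + d)      ≡⟨ cong (_- (+ r + q′ * + d)) eq ⟩
    (+ r′ + q′ * + d) - (+ r + q′ * + d)    ≡⟨ solve₂ q′ (+ r) (+ r′) (+ d) ⟩
    + r′ - + r                              ≡⟨ ℤP.m-n≡m⊖n r′ r ⟩
    r′ ⊖ r                                  ∎
    where
    open ≡-Reasoning
    solve₁ : ∀ q q′ r d → (q - q′) * d ≡ (r + q * d) - (r + q′ * d)
    solve₁ = solve-∀
    solve₂ : ∀ q′ r r′ d → (r′ + q′ * d) - (r + q′ * d) ≡ r′ - r
    solve₂ = solve-∀
  ∣q-q′∣*d<d : ∣ q - q′ ∣ ℕ.* d < d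
  ∣q-q′∣*d<d = ℕP.≤-<-trans (ℕP.≤-reflexive (trans (sym (ℤP.abs-* (q - q′) (+ d))) (cong ∣_∣ [q-q′]*d≡r′⊖r)))
                 (ℕP.≤-<-trans (ℤP.∣m⊝n∣≤m⊔n r′ r) (ℕP.⊔-lub r′<d r<d))
  q≡q′ : q ≡ q′
  q≡q′ = ℤP.i-j≡0⇒i≡j q q′ (ℤP.∣i∣≡0⇒i≡0 (ℕP.n<1⇒n≡0
    (ℕP.*-cancelʳ-< _ _ _ (subst (∣ q - q′ ∣ ℕ.* d <_) (sym (ℕP.*-identityˡ d)) ∣q-q′∣*d<d))))
  r≡r′ : r ≡ r′
  r≡r′ = ℤP.+-injective (∙-cancelʳ (q * + d) _ _ (trans eq (cong (λ z → + r′ + z * + d) (sym q≡q′))))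

%ℕ-/ℕ-unique : ∀ {d r} .{{_ : NonZero d}} (q : ℤ) → r < d →
  (+ r + q * + d) %ℕ d ≡ r × (+ r + q * + d) /ℕ d ≡ q
%ℕ-/ℕ-unique {d} {r} q r<d = divMod-unique (x /ℕ d) q (n%ℕd<d x d) r<d (sym (a≡a%ℕn+[a/ℕn]*n x d))
  where x = + r + q * + d

%ℕ-unique : ∀ {d r} .{{_ : NonZero d}} (q : ℤ) → r < d → (+ r + q * + d) %ℕ d ≡ r
%ℕ-unique q r<d = proj₁ (%ℕ-/ℕ-unique q r<d)

/ℕ-unique : ∀ {d r} .{{_ : NonZero d}} (q : ℤ) → r < d → (+ r + q * + d) /ℕ d ≡ q
/ℕ-unique q r<d = proj₂ (%ℕ-/ℕ-unique q r<d)

n<d⇒n%ℕd≡n : ∀ {d n} .{{_ : NonZero d}} → n < d → (+ n) %ℕ d ≡ n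
n<d⇒n%ℕd≡n {d} {n} n<d = trans (cong (_%ℕ d) (sym (ℤP.+-identityʳ (+ n)))) (%ℕ-unique 0ℤ n<d)

[x+z*d]%ℕd≡x%ℕd : ∀ x z d .{{_ : NonZero d}} → (x + z * + d) %ℕ d ≡ x %ℕ d
[x+z*d]%ℕd≡x%ℕd x z d = trans (cong (_%ℕ d) x+z*d≡) (%ℕ-unique (x /ℕ d + z) (n%ℕd<d x d))
  where
  regroup : ∀ r q z d → (r + q * d) + z * d ≡ r + (q + z) * d
  regroup = solve-∀
  x+z*d≡ : x + z * + d ≡ + (x %ℕ d) + (x /ℕ d + z) * + d
  x+z*d≡ = trans (cong (_+ z * + d) (a≡a%ℕn+[a/ℕn]*n x d)) (regroup (+ (x %ℕ d)) (x /ℕ d) z (+ d))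

[x*[y%ℕd]]%ℕd≡[x*y]%ℕd : ∀ x y d .{{_ : NonZero d}} → (x * + (y %ℕ d)) %ℕ d ≡ (x * y) %ℕ d
[x*[y%ℕd]]%ℕd≡[x*y]%ℕd x y d = sym (begin
  (x * y) %ℕ d                                    ≡⟨ cong (λ z → (x * z) %ℕ d) (a≡a%ℕn+[a/ℕn]*n y d) ⟩
  (x * (+ (y %ℕ d) + y /ℕ d * + d)) %ℕ d          ≡⟨ cong (_%ℕ d) (distrib x (+ (y %ℕ d)) (y /ℕ d) (+ d)) ⟩
  (x * + (y %ℕ d) + x * (y /ℕ d) * + d) %ℕ d      ≡⟨ [x+z*d]%ℕd≡x%ℕd (x * + (y %ℕ d)) (x * (y /ℕ d)) d ⟩
  (x * + (y %ℕ d)) %ℕ d                           ∎)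
  where
  open ≡-Reasoning
  distrib : ∀ x r q d → x * (r + q * d) ≡ x * r + x * q * d
  distrib = solve-∀

bézout⇒inverse : ∀ {M d} → Bézout.Identity 1 M d → ∃₂ λ e k → e * + M ≡ + 1 + k * + d
bézout⇒inverse {M} {d} (Bézout.+- x y 1+yd≡xM) = + x , + y , (begin
  + x * + M          ≡⟨ ℤP.pos-* x M ⟨
  + (x ℕ.* M)        ≡⟨ cong +_ 1+yd≡xM ⟨
  + (1 ℕ.+ y ℕ.* d)  ≡⟨ cong (_+_ (+ 1)) (ℤP.pos-* y d) ⟩
  + 1 + + y * + d    ∎)
  where open ≡-Reasoning
bézout⇒inverse {M} {d} (Bézout.-+ x y 1+xM≡yd) = - + x , - + y , (begin
  - + x * + M                   ≡⟨ solve₁ (+ x) (+ M) ⟩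
  + 1 - (+ 1 + + x * + M)       ≡⟨ cong (λ z → + 1 - (+ 1 + z)) (ℤP.pos-* x M) ⟨
  + 1 - + (1 ℕ.+ x ℕ.* M)       ≡⟨ cong (λ z → + 1 - + z) 1+xM≡yd ⟩
  + 1 - + (y ℕ.* d)             ≡⟨ cong (λ z → + 1 - z) (ℤP.pos-* y d) ⟩
  + 1 - + y * + d               ≡⟨ solve₂ (+ y) (+ d) ⟩
  + 1 + - + y * + d             ∎)
  where
  open ≡-Reasoning
  solve₁ : ∀ x M → - x * M ≡ + 1 - (+ 1 + x * M)
  solve₁ = solve-∀
  solve₂ : ∀ y d → + 1 - y * d ≡ + 1 + - y * d
  solve₂ = solve-∀

coprime⇒inverse : ∀ (m : ℤ) d → gcd ∣ m ∣ d ≡ 1 → ∃₂ λ e k → e * m ≡ + 1 + k * + d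
coprime⇒inverse (+ M)     d gcd≡1 = bézout⇒inverse (coprime-Bézout (gcd≡1⇒coprime {M} {d} gcd≡1))
coprime⇒inverse -[1+ M ] d gcd≡1 with bézout⇒inverse (coprime-Bézout (gcd≡1⇒coprime {suc M} {d} gcd≡1))
... | e , k , eM≡ = - e , k , trans (neg*neg e (+ suc M)) eM≡
  where
  neg*neg : ∀ e M → - e * - M ≡ e * M
  neg*neg = solve-∀

∑<-reindex-*%ℕ : ∀ d .{{_ : NonZero d}} (m : ℤ) → gcd ∣ m ∣ d ≡ 1 →
  ∀ (f : ℕ → ℤ) → ∑< d (λ t → f ((m * + t) %ℕ d)) ≡ ∑< d f
∑<-reindex-*%ℕ d m gcd≡1 with coprime⇒inverse m d gcd≡1
... | e , k , em≡ = ∑<-reindex d (mul m) (mul e) (λ t _ → n%ℕd<d (m * + t) d) (λ t _ → n%ℕd<d (e * + t) d)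
  (mul-inverse m e em≡) (mul-inverse e m (trans (ℤP.*-comm m e) em≡))
  where
  mul : ℤ → ℕ → ℕ
  mul x t = (x * + t) %ℕ d
  mul-inverse : ∀ x y → y * x ≡ + 1 + k * + d → ∀ t → t < d → mul x (mul y t) ≡ t
  mul-inverse x y yx≡ t t<d = begin
    (x * + ((y * + t) %ℕ d)) %ℕ d   ≡⟨ [x*[y%ℕd]]%ℕd≡[x*y]%ℕd x (y * + t) d ⟩
    (x * (y * + t)) %ℕ d            ≡⟨ cong (_%ℕ d) (reassoc x y (+ t)) ⟩
    (y * x * + t) %ℕ d              ≡⟨ cong (λ z → (z * + t) %ℕ d) yx≡ ⟩
    ((+ 1 + k * + d) * + t) %ℕ d    ≡⟨ cong (_%ℕ d) (expand k (+ d) (+ t)) ⟩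
    (+ t + k * + t * + d) %ℕ d      ≡⟨ [x+z*d]%ℕd≡x%ℕd (+ t) (k * + t) d ⟩
    (+ t) %ℕ d                      ≡⟨ n<d⇒n%ℕd≡n t<d ⟩
    t                               ∎
    where
    open ≡-Reasoning
    reassoc : ∀ x y t → x * (y * t) ≡ y * x * t
    reassoc = solve-∀
    expand : ∀ k d t → (+ 1 + k * d) * t ≡ t + k * t * d
    expand = solve-∀

-- w x = 2N ((x/N)), see saw-//.
module Sawtooth (N : ℕ) .{{_ : NonZero N}} where

  sawResidue : ℕ → ℤ
  sawResidue zero        = 0ℤ
  sawResidue r@(suc _)   = + 2 * + r - + N

  w : ℤ → ℤ
  w x = sawResidue (x %ℕ N)

  w-repr : ∀ {r} (q : ℤ) → r < N → w (+ r + q * + N) ≡ sawResidue r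
  w-repr q r<N = cong sawResidue (%ℕ-unique q r<N)

  w-periodic : ∀ x z → w (x + z * + N) ≡ w x
  w-periodic x z = cong sawResidue ([x+z*d]%ℕd≡x%ℕd x z N)

  w-inRange : ∀ {y} → 0 < y → y < N → w (+ y) ≡ + 2 * + y - + N
  w-inRange {suc y} _ y<N = cong sawResidue (n<d⇒n%ℕd≡n y<N)

  w-0 : w 0ℤ ≡ 0ℤ
  w-0 = cong sawResidue (n<d⇒n%ℕd≡n (ℕ.>-nonZero⁻¹ N))

  w-N : w (+ N) ≡ 0ℤ
  w-N = trans (cong w (sym (trans (ℤP.+-identityˡ (+ 1 * + N)) (ℤP.*-identityˡ (+ N))))) (trans (w-periodic 0ℤ (+ 1)) w-0)

  w-odd : ∀ x → w (- x) ≡ - w x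
  w-odd x = odd (x %ℕ N) (n%ℕd<d x N) (a≡a%ℕn+[a/ℕn]*n x N)
    where
    Q = x /ℕ N
    odd : ∀ R → R < N → x ≡ + R + Q * + N → w (- x) ≡ - sawResidue R
    odd zero    _   x≡ = trans (cong w (trans (cong -_ x≡) (negate Q (+ N)))) (w-repr (- Q) (ℕ.>-nonZero⁻¹ N))
      where
      negate : ∀ Q N → - (+ 0 + Q * N) ≡ + 0 + - Q * N
      negate = solve-∀
    odd R@(suc _) R<N x≡ = begin
      w (- x)                                  ≡⟨ cong w (trans (cong -_ x≡) (negate (+ R) Q (+ N))) ⟩
      w (+ N - + R + (- Q - + 1) * + N)        ≡⟨ cong (λ z → w (z + (- Q - + 1) * + N)) +[N∸R]≡ ⟨
      w (+ (N ∸ R) + (- Q - + 1) * + N)        ≡⟨ w-repr (- Q - + 1) (ℕP.∸-monoʳ-< {o = 0} ℕ.z<s (ℕP.<⇒≤ R<N)) ⟩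
      sawResidue (N ∸ R)                       ≡⟨ sawResidue-pos (ℕP.m<n⇒0<n∸m R<N) ⟩
      + 2 * + (N ∸ R) - + N                    ≡⟨ cong (λ z → + 2 * z - + N) +[N∸R]≡ ⟩
      + 2 * (+ N - + R) - + N                  ≡⟨ reflect (+ N) (+ R) ⟩
      - (+ 2 * + R - + N)                      ∎
      where
      open ≡-Reasoning
      +[N∸R]≡ : + (N ∸ R) ≡ + N - + R
      +[N∸R]≡ = trans (sym (ℤP.⊖-≥ (ℕP.<⇒≤ R<N))) (sym (ℤP.m-n≡m⊖n N R))
      sawResidue-pos : ∀ {r} → 0 < r → sawResidue r ≡ + 2 * + r - + N
      sawResidue-pos {suc _} _ = refl
      negate : ∀ R Q N → - (R + Q * N) ≡ N - R + (- Q - + 1) * N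
      negate = solve-∀
      reflect : ∀ N R → + 2 * (N - R) - N ≡ - (+ 2 * R - N)
      reflect = solve-∀

//-+ : ∀ a b m n .{{_ : NonZero m}} .{{_ : NonZero n}} → (a // m) ℚ.+ (b // n) ≡ (a * + n + b * + m) // (m ℕ.* n)
//-+ a b (suc m) (suc n) = trans (sym (fromℚᵘ-toℚᵘ _)) (fromℚᵘ-cong
  (ℚᵘP.≃-trans (ℚP.toℚᵘ-homo-+ (a // suc m) (b // suc n)) (ℚᵘP.+-cong (toℚᵘ-fromℚᵘ (mkℚᵘ a m)) (toℚᵘ-fromℚᵘ (mkℚᵘ b n)))))

//-* : ∀ a b m n .{{_ : NonZero m}} .{{_ : NonZero n}} → (a // m) ℚ.* (b // n) ≡ (a * b) // (m ℕ.* n)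
//-* a b (suc m) (suc n) = trans (sym (fromℚᵘ-toℚᵘ _)) (fromℚᵘ-cong
  (ℚᵘP.≃-trans (ℚP.toℚᵘ-homo-* (a // suc m) (b // suc n)) (ℚᵘP.*-cong (toℚᵘ-fromℚᵘ (mkℚᵘ a m)) (toℚᵘ-fromℚᵘ (mkℚᵘ b n)))))

//-neg : ∀ a n .{{_ : NonZero n}} → ℚ.- (a // n) ≡ (- a) // n
//-neg a (suc n) = trans (sym (fromℚᵘ-toℚᵘ _)) (fromℚᵘ-cong
  (ℚᵘP.≃-trans (ℚP.toℚᵘ-homo‿- (a // suc n)) (ℚᵘP.-‿cong (toℚᵘ-fromℚᵘ (mkℚᵘ a n)))))

//-cong : ∀ a b m n .{{_ : NonZero m}} .{{_ : NonZero n}} → a * + n ≡ b * + m → a // m ≡ b // n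
//-cong a b (suc m) (suc n) eq = fromℚᵘ-cong {mkℚᵘ a m} {mkℚᵘ b n} (*≡* eq)

//-injective : ∀ a b m n .{{_ : NonZero m}} .{{_ : NonZero n}} → a // m ≡ b // n → a * + n ≡ b * + m
//-injective a b (suc m) (suc n) eq with fromℚᵘ-injective {mkℚᵘ a m} {mkℚᵘ b n} eq
... | *≡* eq′ = eq′

floor-// : ∀ x n → ℚ.floor (x // suc n) ≡ x /ℕ suc n
floor-// x n = reduced (x ℚ./ suc n) (ℚP.↥-/ x (suc n)) (ℚP.↧-/ x (suc n))
  where
  N = suc n
  g = gcd ∣ x ∣ N
  reduced : ∀ p → ℚ.↥ p * + g ≡ x → ℚ.↧ p * + g ≡ + N → ℚ.floor p ≡ x /ℕ N
  reduced (mkℚ P D _) P*g≡x [1+D]*g≡N = begin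
    P ℤ./ + suc D                   ≡⟨ div-pos-is-/ℕ P (suc D) ⟩
    Q                               ≡⟨ /ℕ-unique Q Rg<N ⟨
    (+ (R ℕ.* g) + Q * + N) /ℕ N    ≡⟨ cong (_/ℕ N) x≡ ⟨
    x /ℕ N                          ∎
    where
    open ≡-Reasoning
    R = P %ℕ suc D
    Q = P /ℕ suc D
    [1+D]g≡N : suc D ℕ.* g ≡ N
    [1+D]g≡N = ℤP.+-injective (trans (ℤP.pos-* (suc D) g) [1+D]*g≡N)
    instance
      g≢0 : NonZero g
      g≢0 = ℕP.m*n≢0⇒n≢0 (suc D) {{subst NonZero (sym [1+D]g≡N) _}}
    Rg<N : R ℕ.* g < N
    Rg<N = subst (R ℕ.* g <_) [1+D]g≡N (ℕP.*-monoˡ-< g (n%ℕd<d P (suc D)))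
    regroup : ∀ r q d g → (r + q * d) * g ≡ r * g + q * (d * g)
    regroup = solve-∀
    x≡ : x ≡ + (R ℕ.* g) + Q * + N
    x≡ = begin
      x                                  ≡⟨ P*g≡x ⟨
      P * + g                            ≡⟨ cong (_* + g) (a≡a%ℕn+[a/ℕn]*n P (suc D)) ⟩
      (+ R + Q * + suc D) * + g          ≡⟨ regroup (+ R) Q (+ suc D) (+ g) ⟩
      + R * + g + Q * (+ suc D * + g)    ≡⟨ cong₂ (λ u v → u + Q * v) (sym (ℤP.pos-* R g)) [1+D]*g≡N ⟩
      + (R ℕ.* g) + Q * + N              ∎

saw-// : ∀ x n → saw (x // suc n) ≡ Sawtooth.w (suc n) x // (2 ℕ.* suc n)
saw-// x n = trans (cong (sawWithFloor t) (floor-// x n)) (fraction (x %ℕ N) (n%ℕd<d x N) (a≡a%ℕn+[a/ℕn]*n x N))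
  where
  open Sawtooth (suc n)
  N = suc n
  t = x // N
  Q = x /ℕ N
  sawWithFloor : ℚ → ℤ → ℚ
  sawWithFloor t z = if does (t ℚ.≟ (z ℚ./ 1)) then 0ℚ else (t ℚ.- (z ℚ./ 1) ℚ.- ½)
  fraction : ∀ R → R < N → x ≡ + R + Q * + N → sawWithFloor t Q ≡ sawResidue R // (2 ℕ.* N)
  fraction R R<N x≡ with t ℚ.≟ (Q // 1)
  fraction zero    _   x≡ | yes _   = //-cong (+ 0) (+ 0) 1 (2 ℕ.* N) refl
  fraction zero    _   x≡ | no t≢Q =
    ⊥-elim (t≢Q (//-cong x Q N 1 (trans (ℤP.*-identityʳ x) (trans x≡ (ℤP.+-identityˡ (Q * + N))))))
  fraction (suc r) R<N x≡ | yes t≡Q = ⊥-elim (ℕP.1+n≢0 (proj₁ (divMod-unique Q Q R<N ℕ.z<s (begin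
    + suc r + Q * + N ≡⟨ x≡ ⟨
    x                 ≡⟨ ℤP.*-identityʳ x ⟨
    x * + 1           ≡⟨ //-injective x Q N 1 t≡Q ⟩
    Q * + N           ≡⟨ ℤP.+-identityˡ (Q * + N) ⟨
    + 0 + Q * + N     ∎))))
    where open ≡-Reasoning
  fraction (suc r) R<N x≡ | no _ = begin
    x // N ℚ.+ ℚ.- (Q // 1) ℚ.+ ℚ.- ((+ 1) // 2)
      ≡⟨ cong₂ (λ u v → x // N ℚ.+ u ℚ.+ v) (//-neg Q 1) (//-neg (+ 1) 2) ⟩
    x // N ℚ.+ (- Q) // 1 ℚ.+ (- + 1) // 2
      ≡⟨ cong (ℚ._+ (- + 1) // 2) (//-+ x (- Q) N 1) ⟩
    (x * + 1 + - Q * + N) // (N ℕ.* 1) ℚ.+ (- + 1) // 2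
      ≡⟨ //-+ (x * + 1 + - Q * + N) (- + 1) (N ℕ.* 1) 2 ⟩
    numerator x // (N ℕ.* 1 ℕ.* 2)
      ≡⟨ //-cong (numerator x) (+ 2 * + R - + N) (N ℕ.* 1 ℕ.* 2) (2 ℕ.* N) cross ⟩
    (+ 2 * + R - + N) // (2 ℕ.* N) ∎
    where
    open ≡-Reasoning
    R = suc r
    numerator : ℤ → ℤ
    numerator y = (y * + 1 + - Q * + N) * + 2 + - + 1 * (+ N * + 1)
    cross′ : ∀ R Q N →
      (((R + Q * N) * + 1 + - Q * N) * + 2 + - + 1 * (N * + 1)) * (+ 2 * N) ≡ (+ 2 * R - N) * (N * + 1 * + 2)
    cross′ = solve-∀
    cross : numerator x * + (2 ℕ.* N) ≡ (+ 2 * + R - + N) * + (N ℕ.* 1 ℕ.* 2)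
    cross = trans (cong (λ y → numerator y * (+ 2 * + N)) x≡) (cross′ (+ R) Q (+ N))

sum1-cong : ∀ K {f g : ℕ → ℚ} → (∀ k → f k ≡ g k) → sum1 K f ≡ sum1 K g
sum1-cong zero    f≗g = refl
sum1-cong (suc K) f≗g = cong₂ ℚ._+_ (sum1-cong K f≗g) (f≗g (suc K))

sum1-// : ∀ K (g : ℕ → ℤ) M .{{_ : NonZero M}} → sum1 K (λ k → g k // M) ≡ ∑< K (g ∘ suc) // M
sum1-// zero    g M = //-cong (+ 0) (+ 0) 1 M refl
sum1-// (suc K) g M = begin
  sum1 K (λ k → g k // M) ℚ.+ g (suc K) // M   ≡⟨ cong (ℚ._+ g (suc K) // M) (sum1-// K g M) ⟩
  Σ // M ℚ.+ g (suc K) // M                     ≡⟨ //-+ Σ (g (suc K)) M M ⟩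
  (Σ * + M + g (suc K) * + M) // (M ℕ.* M)     ≡⟨ //-cong _ (Σ + g (suc K)) (M ℕ.* M) M {{ℕP.m*n≢0 M M}} cross ⟩
  (Σ + g (suc K)) // M                          ≡⟨ cong (_// M) (∑<-snoc K (g ∘ suc)) ⟨
  ∑< (suc K) (g ∘ suc) // M                     ∎
  where
  open ≡-Reasoning
  Σ = ∑< K (g ∘ suc)
  factor : ∀ a b M → (a * M + b * M) * M ≡ (a + b) * (M * M)
  factor = solve-∀
  cross : (Σ * + M + g (suc K) * + M) * + M ≡ (Σ + g (suc K)) * + (M ℕ.* M)
  cross = trans (factor Σ (g (suc K)) (+ M)) (cong (λ z → (Σ + g (suc K)) * z) (sym (ℤP.pos-* M M)))

S≡3∑/N² : ∀ n (h : ℤ) → let open Sawtooth (suc n) in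
  S h (suc n) ≡ (+ 3 * ∑< (suc n) (λ k → w (+ k) * w (h * + k))) // (suc n ℕ.* suc n)
S≡3∑/N² n h = begin
  twelve ℚ.* sum1 N (λ k → saw ((+ k) // N) ℚ.* saw ((h * + k) // N))
    ≡⟨ cong (twelve ℚ.*_) (sum1-cong N term) ⟩
  twelve ℚ.* sum1 N (λ k → f k // 4N²)
    ≡⟨ cong (twelve ℚ.*_) (sum1-// N f 4N²) ⟩
  twelve ℚ.* (∑< N (f ∘ suc) // 4N²)
    ≡⟨ cong (λ z → twelve ℚ.* (z // 4N²)) (∑<-rotate N f f0≡fN) ⟩
  twelve ℚ.* (∑< N f // 4N²)
    ≡⟨ //-* (+ 12) (∑< N f) 1 4N² ⟩
  (+ 12 * ∑< N f) // (1 ℕ.* 4N²)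
    ≡⟨ //-cong (+ 12 * ∑< N f) (+ 3 * ∑< N f) (1 ℕ.* 4N²) (N ℕ.* N) (cross (∑< N f) (+ N)) ⟩
  (+ 3 * ∑< N f) // (N ℕ.* N) ∎
  where
  open ≡-Reasoning
  open Sawtooth (suc n)
  N = suc n
  2N = 2 ℕ.* N
  4N² = 2N ℕ.* 2N
  twelve = (+ 12) // 1
  f : ℕ → ℤ
  f k = w (+ k) * w (h * + k)
  term : ∀ k → saw ((+ k) // N) ℚ.* saw ((h * + k) // N) ≡ f k // 4N²
  term k = trans (cong₂ ℚ._*_ (saw-// (+ k) n) (saw-// (h * + k) n)) (//-* (w (+ k)) (w (h * + k)) 2N 2N)
  f0≡fN : f 0 ≡ f N
  f0≡fN = trans (cong (λ z → z * w (h * + 0)) w-0) (trans (ℤP.*-zeroˡ (w (h * + 0)))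
            (sym (trans (cong (λ z → z * w (h * + N)) w-N) (ℤP.*-zeroˡ (w (h * + N))))))
  cross : ∀ Σ N → (+ 12 * Σ) * (N * N) ≡ (+ 3 * Σ) * (+ 1 * ((+ 2 * N) * (+ 2 * N)))
  cross = solve-∀

//-closedForm : ∀ n (ε A : ℤ) → let N = suc n in
  (ε * (+ N * (+ 2 + A - + 3 * + N))) // (N ℕ.* N) ≡ (ε // 1) ℚ.* (((+ 2) // N) ℚ.+ (A // N) ℚ.- ((+ 3) // 1))
//-closedForm n ε A = sym (begin
  (ε // 1) ℚ.* ((+ 2) // N ℚ.+ A // N ℚ.+ ℚ.- ((+ 3) // 1))
    ≡⟨ cong (λ z → ε // 1 ℚ.* ((+ 2) // N ℚ.+ A // N ℚ.+ z)) (//-neg (+ 3) 1) ⟩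
  (ε // 1) ℚ.* ((+ 2) // N ℚ.+ A // N ℚ.+ (- + 3) // 1)
    ≡⟨ cong (λ z → ε // 1 ℚ.* (z ℚ.+ (- + 3) // 1)) (//-+ (+ 2) A N N) ⟩
  (ε // 1) ℚ.* ((+ 2 * + N + A * + N) // (N ℕ.* N) ℚ.+ (- + 3) // 1)
    ≡⟨ cong (ε // 1 ℚ.*_) (//-+ (+ 2 * + N + A * + N) (- + 3) (N ℕ.* N) 1) ⟩
  (ε // 1) ℚ.* (B // (N ℕ.* N ℕ.* 1))
    ≡⟨ //-* ε B 1 (N ℕ.* N ℕ.* 1) ⟩
  (ε * B) // (1 ℕ.* (N ℕ.* N ℕ.* 1))
    ≡⟨ //-cong (ε * B) (ε * (+ N * (+ 2 + A - + 3 * + N))) (1 ℕ.* (N ℕ.* N ℕ.* 1)) (N ℕ.* N) (cross ε A (+ N)) ⟩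
  (ε * (+ N * (+ 2 + A - + 3 * + N))) // (N ℕ.* N) ∎)
  where
  open ≡-Reasoning
  N = suc n
  B = (+ 2 * + N + A * + N) * + 1 + - + 3 * + (N ℕ.* N)
  cross : ∀ ε A N → (ε * ((+ 2 * N + A * N) * + 1 + - + 3 * (N * N))) * (N * N)
                    ≡ (ε * (N * (+ 2 + A - + 3 * N))) * (+ 1 * (N * N * + 1))
  cross = solve-∀

module DedekindCore (N c d : ℕ) {{N≢0 : NonZero N}} {{d≢0 : NonZero d}} (N≡cdd : N ≡ c ℕ.* d ℕ.* d) (m : ℤ) where

  open Sawtooth N

  a : ℕ
  a = c ℕ.* d

  h : ℤ
  h = + 1 + + a * m

  u : ℕ → ℕ
  u t = (m * + t) %ℕ d

  shift : ℕ → ℕ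
  shift t = c ℕ.* u t

  V : ℕ → ℤ
  V y = + 2 * + y - + N

  L : ℕ → ℕ → ℤ
  L t j = + 2 * + d * + j + (+ 2 * + t - + N)

  -- The term (2d)^2 a s (a - s) / 2 of ∑<-linear-autocorrelation for the rotation s = c v.
  defect : ℕ → ℤ
  defect v = + 2 * (+ d * + d) * + a * (+ c * + v) * (+ a - + c * + v)

  classSum : ℕ → ℤ
  classSum t = ∑< a (λ j → w (+ (j ℕ.* d ℕ.+ t)) * w (h * + (j ℕ.* d ℕ.+ t)))

  classSquares : ℕ → ℤ
  classSquares t = ∑< a (λ j → V (j ℕ.* d ℕ.+ t) * V (j ℕ.* d ℕ.+ t))

  +a≡ : + a ≡ + c * + d
  +a≡ = ℤP.pos-* c d

  +N≡ : + N ≡ + c * + d * + d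
  +N≡ = trans (cong +_ N≡cdd) (trans (ℤP.pos-* a d) (cong (_* + d) +a≡))

  instance
    a≢0 : NonZero a
    a≢0 = ℕP.m*n≢0⇒m≢0 a {{subst NonZero N≡cdd N≢0}}

  ∑<-classes : ∀ f → ∑< N f ≡ ∑< d (λ t → ∑< a (λ j → f (j ℕ.* d ℕ.+ t)))
  ∑<-classes f = trans (cong (λ n → ∑< n f) N≡cdd) (trans (∑<-* a d f) (∑<-comm a d (λ j t → f (j ℕ.* d ℕ.+ t))))

  jd+t<N : ∀ {j t} → j < a → t < d → j ℕ.* d ℕ.+ t < N
  jd+t<N {j} {t} j<a t<d = subst (j ℕ.* d ℕ.+ t <_) (sym N≡cdd) (begin-strict
    j ℕ.* d ℕ.+ t    <⟨ ℕP.+-monoʳ-< (j ℕ.* d) t<d ⟩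
    j ℕ.* d ℕ.+ d    ≡⟨ ℕP.+-comm (j ℕ.* d) d ⟩
    suc j ℕ.* d      ≤⟨ ℕP.*-monoˡ-≤ d j<a ⟩
    a ℕ.* d          ∎)
    where open ℕP.≤-Reasoning

  h*[jd+t] : ∀ j t → h * + (j ℕ.* d ℕ.+ t) ≡ + ((j ℕ.+ shift t) ℕ.* d ℕ.+ t) + (m * + j + (m * + t) /ℕ d) * + N
  h*[jd+t] j t = begin
    h * + (j ℕ.* d ℕ.+ t)
      ≡⟨ cong₂ (λ x y → (+ 1 + x * m) * y) +a≡ (pos-*-+ j d t) ⟩
    (+ 1 + + c * + d * m) * (+ j * + d + + t)
      ≡⟨ expand m (+ j) (+ d) (+ t) (+ c) ⟩
    + j * + d + + t + + c * + d * m * + j * + d + + c * + d * (m * + t)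
      ≡⟨ cong (λ z → + j * + d + + t + + c * + d * m * + j * + d + + c * + d * z) (a≡a%ℕn+[a/ℕn]*n (m * + t) d) ⟩
    + j * + d + + t + + c * + d * m * + j * + d + + c * + d * (+ u t + Q * + d)
      ≡⟨ collect m (+ j) (+ d) (+ t) (+ c) (+ u t) Q ⟩
    ((+ j + + c * + u t) * + d + + t) + (m * + j + Q) * (+ c * + d * + d)
      ≡⟨ cong₂ (λ x y → x + (m * + j + Q) * y) cast +N≡ ⟨
    + ((j ℕ.+ shift t) ℕ.* d ℕ.+ t) + (m * + j + Q) * + N ∎
    where
    open ≡-Reasoning
    Q = (m * + t) /ℕ d
    cast : + ((j ℕ.+ shift t) ℕ.* d ℕ.+ t) ≡ (+ j + + c * + u t) * + d + + t
    cast = trans (pos-*-+ (j ℕ.+ shift t) d t)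
                 (cong (λ z → z * + d + + t) (trans (ℤP.pos-+ j (shift t)) (cong (_+_ (+ j)) (ℤP.pos-* c (u t)))))
    expand : ∀ m J D T C → (+ 1 + C * D * m) * (J * D + T) ≡ J * D + T + C * D * m * J * D + C * D * (m * T)
    expand = solve-∀
    collect : ∀ m J D T C U Q →
      J * D + T + C * D * m * J * D + C * D * (U + Q * D) ≡ ((J + C * U) * D + T) + (m * J + Q) * (C * D * D)
    collect = solve-∀

  w-h* : ∀ j t → w (h * + (j ℕ.* d ℕ.+ t)) ≡ w (+ ((j ℕ.+ shift t) ℕ.* d ℕ.+ t))
  w-h* j t = trans (cong w (h*[jd+t] j t)) (w-periodic (+ ((j ℕ.+ shift t) ℕ.* d ℕ.+ t)) (m * + j + (m * + t) /ℕ d))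

  V≡L : ∀ t j → V (j ℕ.* d ℕ.+ t) ≡ L t j
  V≡L t j = trans (cong (λ z → + 2 * z - + N) (pos-*-+ j d t)) (affine (+ j) (+ d) (+ t) (+ N))
    where
    affine : ∀ J D T N → + 2 * (J * D + T) - N ≡ + 2 * D * J + (+ 2 * T - N)
    affine = solve-∀

  w≡L : ∀ {t j} → 0 < t → t < d → j < a → w (+ (j ℕ.* d ℕ.+ t)) ≡ L t j
  w≡L {t} {j} 0<t t<d j<a = trans (w-inRange (ℕP.<-≤-trans 0<t (ℕP.m≤n+m t (j ℕ.* d))) (jd+t<N j<a t<d)) (V≡L t j)

  shift≤a : ∀ t → shift t ≤ a
  shift≤a t = ℕP.*-monoʳ-≤ c (ℕP.<⇒≤ (n%ℕd<d (m * + t) d))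

  classSum-rotated : ∀ t → 0 < t → t < d → let sₜ = shift t; x = a ∸ sₜ in
    classSum t ≡ ∑< x (λ j → L t j * L t (j ℕ.+ sₜ)) + ∑< sₜ (λ i → L t (x ℕ.+ i) * L t i)
  classSum-rotated t 0<t t<d = begin
    classSum t                                ≡⟨ ∑<-cong a (λ j _ → cong (w (+ (j ℕ.* d ℕ.+ t)) *_) (w-h* j t)) ⟩
    ∑< a G                                    ≡⟨ cong (λ n → ∑< n G) x+sₜ≡a ⟨
    ∑< (x ℕ.+ sₜ) G                            ≡⟨ ∑<-+ x sₜ G ⟩
    ∑< x G + ∑< sₜ (λ i → G (x ℕ.+ i))         ≡⟨ cong₂ _+_ (∑<-cong x unwrapped) (∑<-cong sₜ wrapped) ⟩
    ∑< x (λ j → L t j * L t (j ℕ.+ sₜ)) + ∑< sₜ (λ i → L t (x ℕ.+ i) * L t i) ∎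
    where
    open ≡-Reasoning
    sₜ = shift t
    x = a ∸ sₜ
    x+sₜ≡a : x ℕ.+ sₜ ≡ a
    x+sₜ≡a = ℕP.m∸n+n≡m (shift≤a t)
    G : ℕ → ℤ
    G j = w (+ (j ℕ.* d ℕ.+ t)) * w (+ ((j ℕ.+ sₜ) ℕ.* d ℕ.+ t))
    unwrapped : ∀ j → j < x → G j ≡ L t j * L t (j ℕ.+ sₜ)
    unwrapped j j<x = cong₂ _*_ (w≡L 0<t t<d (ℕP.≤-<-trans (ℕP.m≤m+n j sₜ) j+sₜ<a)) (w≡L 0<t t<d j+sₜ<a)
      where
      j+sₜ<a : j ℕ.+ sₜ < a
      j+sₜ<a = subst (j ℕ.+ sₜ <_) x+sₜ≡a (ℕP.+-monoˡ-< sₜ j<x)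
    [x+i+sₜ]d+t≡ : ∀ i → + ((x ℕ.+ i ℕ.+ sₜ) ℕ.* d ℕ.+ t) ≡ + (i ℕ.* d ℕ.+ t) + + 1 * + N
    [x+i+sₜ]d+t≡ i = begin
      + ((x ℕ.+ i ℕ.+ sₜ) ℕ.* d ℕ.+ t)           ≡⟨ cong +_ (reorder x i sₜ d t) ⟩
      + ((i ℕ.* d ℕ.+ t) ℕ.+ (x ℕ.+ sₜ) ℕ.* d)   ≡⟨ cong (λ z → + ((i ℕ.* d ℕ.+ t) ℕ.+ z ℕ.* d)) x+sₜ≡a ⟩
      + ((i ℕ.* d ℕ.+ t) ℕ.+ a ℕ.* d)           ≡⟨ cong (λ z → + ((i ℕ.* d ℕ.+ t) ℕ.+ z)) N≡cdd ⟨
      + ((i ℕ.* d ℕ.+ t) ℕ.+ N)                 ≡⟨ ℤP.pos-+ (i ℕ.* d ℕ.+ t) N ⟩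
      + (i ℕ.* d ℕ.+ t) + + N                   ≡⟨ cong (_+_ (+ (i ℕ.* d ℕ.+ t))) (ℤP.*-identityˡ (+ N)) ⟨
      + (i ℕ.* d ℕ.+ t) + + 1 * + N             ∎
      where
      reorder : ∀ x i sₜ d t → (x ℕ.+ i ℕ.+ sₜ) ℕ.* d ℕ.+ t ≡ (i ℕ.* d ℕ.+ t) ℕ.+ (x ℕ.+ sₜ) ℕ.* d
      reorder = NS.solve-∀
    wrapped : ∀ i → i < sₜ → G (x ℕ.+ i) ≡ L t (x ℕ.+ i) * L t i
    wrapped i i<sₜ = cong₂ _*_ (w≡L 0<t t<d (subst (x ℕ.+ i <_) x+sₜ≡a (ℕP.+-monoʳ-< x i<sₜ))) (begin
      w (+ ((x ℕ.+ i ℕ.+ sₜ) ℕ.* d ℕ.+ t))        ≡⟨ cong w ([x+i+sₜ]d+t≡ i) ⟩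
      w (+ (i ℕ.* d ℕ.+ t) + + 1 * + N)            ≡⟨ w-periodic (+ (i ℕ.* d ℕ.+ t)) (+ 1) ⟩
      w (+ (i ℕ.* d ℕ.+ t))                        ≡⟨ w≡L 0<t t<d (ℕP.<-≤-trans i<sₜ (shift≤a t)) ⟩
      L t i                                        ∎)

  classSum-pos : ∀ t → 0 < t → t < d → classSum t ≡ classSquares t - defect (u t)
  classSum-pos t 0<t t<d = ℤP.*-cancelˡ-≡ (+ 2) _ _ (begin
    + 2 * classSum t
      ≡⟨ cong (+ 2 *_) (classSum-rotated t 0<t t<d) ⟩
    + 2 * (∑< x (λ j → L t j * L t (j ℕ.+ sₜ)) + ∑< sₜ (λ i → L t (x ℕ.+ i) * L t i))
      ≡⟨ ∑<-linear-autocorrelation α (+ 2 * + t - + N) x sₜ ⟩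
    + 2 * ∑< (x ℕ.+ sₜ) (λ j → L t j * L t j) - α * α * + (x ℕ.+ sₜ) * + sₜ * + x
      ≡⟨ cong₂ (λ Σ z → + 2 * Σ - α * α * z * + sₜ * + x) squares (cong +_ x+sₜ≡a) ⟩
    + 2 * classSquares t - α * α * + a * + sₜ * + x
      ≡⟨ cong₂ (λ σ ξ → + 2 * classSquares t - α * α * + a * σ * ξ) +sₜ≡ +x≡ ⟩
    + 2 * classSquares t - α * α * + a * (+ c * + u t) * (+ a - + c * + u t)
      ≡⟨ double (classSquares t) (+ d) (+ a) (+ c * + u t) ⟩
    + 2 * (classSquares t - defect (u t)) ∎)
    where
    open ≡-Reasoning
    sₜ = shift t
    x = a ∸ sₜ
    α = + 2 * + d
    x+sₜ≡a : x ℕ.+ sₜ ≡ a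
    x+sₜ≡a = ℕP.m∸n+n≡m (shift≤a t)
    +sₜ≡ : + sₜ ≡ + c * + u t
    +sₜ≡ = ℤP.pos-* c (u t)
    +x≡ : + x ≡ + a - + c * + u t
    +x≡ = trans (sym (ℤP.⊖-≥ (shift≤a t))) (trans (sym (ℤP.m-n≡m⊖n a sₜ)) (cong (λ z → + a - z) +sₜ≡))
    squares : ∑< (x ℕ.+ sₜ) (λ j → L t j * L t j) ≡ classSquares t
    squares = trans (cong (λ n → ∑< n (λ j → L t j * L t j)) x+sₜ≡a)
                    (∑<-cong a (λ j _ → sym (cong₂ _*_ (V≡L t j) (V≡L t j))))
    double : ∀ Σ D A S → + 2 * Σ - + 2 * D * (+ 2 * D) * A * S * (A - S) ≡ + 2 * (Σ - + 2 * (D * D) * A * S * (A - S))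
    double = solve-∀

  -- The class t = 0 contains k = 0, where w vanishes although V does not.
  classSum-0 : classSum 0 ≡ classSquares 0 - defect (u 0) - + N * + N
  classSum-0 = begin
    classSum 0
      ≡⟨ ∑<-cong a (λ j _ → cong (w (y j) *_) (w-h*0 j)) ⟩
    ∑< a (λ j → w (y j) * w (y j))
      ≡⟨ ∑<-head a (λ j → w (y j) * w (y j)) ⟩
    w 0ℤ * w 0ℤ + ∑< (ℕ.pred a) (λ j → w (y (suc j)) * w (y (suc j)))
      ≡⟨ cong₂ (λ z Σ → z * z + Σ) w-0 (∑<-cong (ℕ.pred a) (λ j j<pred-a → cong (λ z → z * z) (w≡V j j<pred-a))) ⟩
    0ℤ * 0ℤ + Σ
      ≡⟨ restore (+ N) Σ (+ d) (+ a) (+ c) ⟩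
    (V 0 * V 0 + Σ) - defect 0 - + N * + N
      ≡⟨ cong₂ (λ z v → z - defect v - + N * + N) (∑<-head a (λ j → V (j ℕ.* d ℕ.+ 0) * V (j ℕ.* d ℕ.+ 0))) u0≡0 ⟨
    classSquares 0 - defect (u 0) - + N * + N ∎
    where
    open ≡-Reasoning
    y : ℕ → ℤ
    y j = + (j ℕ.* d ℕ.+ 0)
    Σ = ∑< (ℕ.pred a) (λ j → V (suc j ℕ.* d ℕ.+ 0) * V (suc j ℕ.* d ℕ.+ 0))
    u0≡0 : u 0 ≡ 0
    u0≡0 = trans (cong (_%ℕ d) (ℤP.*-zeroʳ m)) (n<d⇒n%ℕd≡n (ℕ.>-nonZero⁻¹ d))
    w-h*0 : ∀ j → w (h * y j) ≡ w (y j)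
    w-h*0 j = trans (w-h* j 0) (cong (λ z → w (+ (z ℕ.* d ℕ.+ 0))) j+shift0≡j)
      where
      j+shift0≡j : j ℕ.+ shift 0 ≡ j
      j+shift0≡j = trans (cong (λ z → j ℕ.+ c ℕ.* z) u0≡0) (trans (cong (j ℕ.+_) (ℕP.*-zeroʳ c)) (ℕP.+-identityʳ j))
    w≡V : ∀ j → j < ℕ.pred a → w (y (suc j)) ≡ V (suc j ℕ.* d ℕ.+ 0)
    w≡V j j<pred-a = w-inRange (ℕP.<-≤-trans (ℕ.>-nonZero⁻¹ d) (ℕP.≤-trans (ℕP.m≤m+n d (j ℕ.* d)) (ℕP.m≤m+n _ 0)))
                               (jd+t<N (subst (suc j <_) (ℕP.suc-pred a) (ℕ.s≤s j<pred-a)) (ℕ.>-nonZero⁻¹ d))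
    restore : ∀ N Σ D A C →
      0ℤ * 0ℤ + Σ ≡ ((+ 2 * + 0 - N) * (+ 2 * + 0 - N) + Σ) - + 2 * (D * D) * A * (C * + 0) * (A - C * + 0) - N * N
    restore = solve-∀

  ∑ww≡ : gcd ∣ m ∣ d ≡ 1 →
    ∑< N (λ k → w (+ k) * w (h * + k)) ≡ ∑< N (λ k → V k * V k) - ∑< d defect - + N * + N
  ∑ww≡ gcd≡1 = begin
    ∑< N (λ k → w (+ k) * w (h * + k))
      ≡⟨ ∑<-classes (λ k → w (+ k) * w (h * + k)) ⟩
    ∑< d classSum
      ≡⟨ ∑<-head d classSum ⟩
    classSum 0 + ∑< (ℕ.pred d) (classSum ∘ suc)
      ≡⟨ cong₂ _+_ classSum-0 (∑<-cong (ℕ.pred d) (λ t t<pred-d → classSum-pos (suc t) ℕ.z<s (suc<d t<pred-d))) ⟩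
    (F 0 - + N * + N) + ∑< (ℕ.pred d) (F ∘ suc)
      ≡⟨ regroup (F 0) (+ N * + N) (∑< (ℕ.pred d) (F ∘ suc)) ⟩
    (F 0 + ∑< (ℕ.pred d) (F ∘ suc)) - + N * + N
      ≡⟨ cong (_- + N * + N) (∑<-head d F) ⟨
    ∑< d F - + N * + N
      ≡⟨ cong (_- + N * + N) (∑<-distrib-- d classSquares (defect ∘ u)) ⟩
    ∑< d classSquares - ∑< d (defect ∘ u) - + N * + N
      ≡⟨ cong₂ (λ p q → p - q - + N * + N) (sym (∑<-classes (λ k → V k * V k))) (∑<-reindex-*%ℕ d m gcd≡1 defect) ⟩
    ∑< N (λ k → V k * V k) - ∑< d defect - + N * + N ∎
    where
    open ≡-Reasoning
    F : ℕ → ℤ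
    F t = classSquares t - defect (u t)
    suc<d : ∀ {t} → t < ℕ.pred d → suc t < d
    suc<d t<pred-d = subst (suc _ <_) (ℕP.suc-pred d) (ℕ.s≤s t<pred-d)
    regroup : ∀ x y z → (x - y) + z ≡ (x + z) - y
    regroup = solve-∀

  6∑defect : + 6 * ∑< d defect ≡ + 2 * (+ d * + d) * + a * (+ c * + c) * (+ d * + d * + d - + d)
  6∑defect = begin
    + 6 * ∑< d defect           ≡⟨ cong (+ 6 *_) (trans (∑<-cong d (λ t _ → defect≡ t)) (sym (*-distribˡ-∑< d K T))) ⟩
    + 6 * (K * ∑< d T)          ≡⟨ ℤP.*-assoc (+ 6) K (∑< d T) ⟨
    + 6 * K * ∑< d T            ≡⟨ cong (_* ∑< d T) (ℤP.*-comm (+ 6) K) ⟩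
    K * + 6 * ∑< d T            ≡⟨ ℤP.*-assoc K (+ 6) (∑< d T) ⟩
    K * (+ 6 * ∑< d T)          ≡⟨ cong (K *_) (∑<-k[n-k] d) ⟩
    K * (+ d * + d * + d - + d) ∎
    where
    open ≡-Reasoning
    K = + 2 * (+ d * + d) * + a * (+ c * + c)
    T : ℕ → ℤ
    T t = + t * (+ d - + t)
    factor : ∀ D A C T → + 2 * (D * D) * A * (C * T) * (C * D - C * T) ≡ + 2 * (D * D) * A * (C * C) * (T * (D - T))
    factor = solve-∀
    defect≡ : ∀ t → defect t ≡ K * T t
    defect≡ t = trans (cong (λ α → + 2 * (+ d * + d) * + a * (+ c * + t) * (α - + c * + t)) +a≡)
                      (factor (+ d) (+ a) (+ c) (+ t))

  3∑ww≡ : gcd ∣ m ∣ d ≡ 1 → + 3 * ∑< N (λ k → w (+ k) * w (h * + k)) ≡ + N * (+ 2 + + a * + a - + 3 * + N)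
  3∑ww≡ gcd≡1 = ℤP.*-cancelˡ-≡ (+ 2) _ _ (begin
    + 2 * (+ 3 * ∑ww)
      ≡⟨ cong (λ z → + 2 * (+ 3 * z)) (∑ww≡ gcd≡1) ⟩
    + 2 * (+ 3 * (ΣV² - Σdefect - + N * + N))
      ≡⟨ regroup ΣV² Σdefect (+ N) ⟩
    + 2 * (+ 3 * ΣV²) - + 6 * Σdefect - + 6 * (+ N * + N)
      ≡⟨ cong₂ (λ p q → + 2 * p - q - + 6 * (+ N * + N)) (∑<-[2k-n]² N) 6∑defect ⟩
    lhs (+ N) (+ a)
      ≡⟨ cong₂ lhs +N≡ +a≡ ⟩
    lhs (+ c * + d * + d) (+ c * + d)
      ≡⟨ closedForm (+ c) (+ d) ⟩
    rhs (+ c * + d * + d) (+ c * + d)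
      ≡⟨ cong₂ rhs +N≡ +a≡ ⟨
    rhs (+ N) (+ a) ∎)
    where
    open ≡-Reasoning
    ∑ww = ∑< N (λ k → w (+ k) * w (h * + k))
    ΣV² = ∑< N (λ k → V k * V k)
    Σdefect = ∑< d defect
    lhs rhs : ℤ → ℤ → ℤ
    lhs n α = + 2 * (n * n * n + + 2 * n) - + 2 * (+ d * + d) * α * (+ c * + c) * (+ d * + d * + d - + d) - + 6 * (n * n)
    rhs n α = + 2 * (n * (+ 2 + α * α - + 3 * n))
    regroup : ∀ V B N → + 2 * (+ 3 * (V - B - N * N)) ≡ + 2 * (+ 3 * V) - + 6 * B - + 6 * (N * N)
    regroup = solve-∀
    closedForm : ∀ C D →
        + 2 * ((C * D * D) * (C * D * D) * (C * D * D) + + 2 * (C * D * D)) - + 2 * (D * D) * (C * D) * (C * C) * (D * D * D - D)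
          - + 6 * ((C * D * D) * (C * D * D))
      ≡ + 2 * ((C * D * D) * (+ 2 + (C * D) * (C * D) - + 3 * (C * D * D)))
    closedForm = solve-∀

3∑ww≡± : ∀ N c d {{_ : NonZero N}} {{_ : NonZero d}} → N ≡ c ℕ.* d ℕ.* d →
  ∀ (ε m : ℤ) → ε ≡ + 1 ⊎ ε ≡ - + 1 → gcd ∣ m ∣ d ≡ 1 → let open Sawtooth N; a = c ℕ.* d in
  + 3 * ∑< N (λ k → w (+ k) * w ((ε + + a * m) * + k)) ≡ ε * (+ N * (+ 2 + + a * + a - + 3 * + N))
3∑ww≡± N c d N≡cdd .(+ 1) m (inj₁ refl) gcd≡1 =
  trans (DedekindCore.3∑ww≡ N c d N≡cdd m gcd≡1) (sym (ℤP.*-identityˡ _))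
3∑ww≡± N c d N≡cdd .(- + 1) m (inj₂ refl) gcd≡1 = begin
  + 3 * ∑< N (λ k → w (+ k) * w ((- + 1 + + a * m) * + k))  ≡⟨ cong (+ 3 *_) (∑<-cong N (λ k _ → flip (+ k))) ⟩
  + 3 * ∑< N (λ k → - (w (+ k) * w (h * + k)))              ≡⟨ cong (+ 3 *_) (∑<-neg N (λ k → w (+ k) * w (h * + k))) ⟩
  + 3 * - ∑< N (λ k → w (+ k) * w (h * + k))                ≡⟨ ℤP.neg-distribʳ-* (+ 3) _ ⟨
  - (+ 3 * ∑< N (λ k → w (+ k) * w (h * + k)))              ≡⟨ cong -_ (DedekindCore.3∑ww≡ N c d N≡cdd (- m) gcd≡1′) ⟩
  - X                                                       ≡⟨ ℤP.-1*i≡-i X ⟨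
  - + 1 * X                                                 ∎
  where
  open ≡-Reasoning
  open Sawtooth N
  a = c ℕ.* d
  h = + 1 + + a * - m
  X = + N * (+ 2 + + a * + a - + 3 * + N)
  negate : ∀ A m k → (- + 1 + A * m) * k ≡ - ((+ 1 + A * - m) * k)
  negate = solve-∀
  flip : ∀ k → w k * w ((- + 1 + + a * m) * k) ≡ - (w k * w (h * k))
  flip k = trans (cong (λ z → w k * w z) (negate (+ a) m k))
                 (trans (cong (w k *_) (w-odd (h * k))) (sym (ℤP.neg-distribʳ-* (w k) _)))
  gcd≡1′ : gcd ∣ - m ∣ d ≡ 1
  gcd≡1′ = trans (cong (λ z → gcd z d) (ℤP.∣-i∣≡∣i∣ m)) gcd≡1

S[ε+am]≡ : ∀ n a d {{_ : NonZero d}} → suc n ≡ a ℕ.* d → d ∣ a →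
  ∀ (ε m : ℤ) → ε ≡ + 1 ⊎ ε ≡ - + 1 → gcd ∣ m ∣ d ≡ 1 →
  S (ε + + a * m) (suc n) ≡ (ε // 1) ℚ.* (((+ 2) // suc n) ℚ.+ ((+ (a ℕ.* a)) // suc n) ℚ.- ((+ 3) // 1))
S[ε+am]≡ n .(c ℕ.* d) d N≡ad (divides c refl) ε m ε≡±1 gcd≡1 = begin
  S (ε + + a * m) N
    ≡⟨ S≡3∑/N² n (ε + + a * m) ⟩
  (+ 3 * ∑< N (λ k → w (+ k) * w ((ε + + a * m) * + k))) // (N ℕ.* N)
    ≡⟨ cong (_// (N ℕ.* N)) (3∑ww≡± N c d N≡ad ε m ε≡±1 gcd≡1) ⟩
  (ε * (+ N * (+ 2 + + a * + a - + 3 * + N))) // (N ℕ.* N)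
    ≡⟨ cong (λ A → (ε * (+ N * (+ 2 + A - + 3 * + N))) // (N ℕ.* N)) (ℤP.pos-* a a) ⟨
  (ε * (+ N * (+ 2 + + (a ℕ.* a) - + 3 * + N))) // (N ℕ.* N)
    ≡⟨ //-closedForm n ε (+ (a ℕ.* a)) ⟩
  (ε // 1) ℚ.* (((+ 2) // N) ℚ.+ ((+ (a ℕ.* a)) // N) ℚ.- ((+ 3) // 1)) ∎
  where
  open ≡-Reasoning
  open Sawtooth (suc n)
  N = suc n
  a = c ℕ.* d

lᵏ≡lʳq*d : ∀ l k r q d → r ≤ k → l ^ (k ∸ r) ≡ d ℕ.* q → l ^ k ≡ l ^ r ℕ.* q ℕ.* d
lᵏ≡lʳq*d l k r q d r≤k lᵏ⁻ʳ≡dq = begin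
  l ^ k                         ≡⟨ cong (l ^_) (ℕP.m+[n∸m]≡n r≤k) ⟨
  l ^ (r ℕ.+ (k ∸ r))           ≡⟨ ℕP.^-distribˡ-+-* l r (k ∸ r) ⟩
  l ^ r ℕ.* l ^ (k ∸ r)         ≡⟨ cong (l ^ r ℕ.*_) lᵏ⁻ʳ≡dq ⟩
  l ^ r ℕ.* (d ℕ.* q)           ≡⟨ reorder (l ^ r) d q ⟩
  l ^ r ℕ.* q ℕ.* d             ∎
  where
  open ≡-Reasoning
  reorder : ∀ x d q → x ℕ.* (d ℕ.* q) ≡ x ℕ.* q ℕ.* d
  reorder = NS.solve-∀

k∸2r+r≡k∸r : ∀ k r → 2 ℕ.* r ≤ k → k ∸ 2 ℕ.* r ℕ.+ r ≡ k ∸ r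
k∸2r+r≡k∸r k r 2r≤k = begin
  k ∸ 2 ℕ.* r ℕ.+ r           ≡⟨ cong (λ z → k ∸ (r ℕ.+ z) ℕ.+ r) (ℕP.+-identityʳ r) ⟩
  k ∸ (r ℕ.+ r) ℕ.+ r         ≡⟨ cong (ℕ._+ r) (ℕP.∸-+-assoc k r r) ⟨
  k ∸ r ∸ r ℕ.+ r             ≡⟨ ℕP.m∸n+n≡m r≤k∸r ⟩
  k ∸ r                       ∎
  where
  open ≡-Reasoning
  r≤k∸r : r ≤ k ∸ r
  r≤k∸r = ℕP.m+n≤o⇒m≤o∸n r (subst (ℕ._≤ k) (cong (r ℕ.+_) (ℕP.+-identityʳ r)) 2r≤k)

d∣lʳq : ∀ l k r q d .{{_ : NonZero l}} → r ≤ k → l ^ (k ∸ r) ≡ d ℕ.* q →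
  (k ≤ 2 ℕ.* r ⊎ (2 ℕ.* r < k × l ^ (k ∸ 2 ℕ.* r) ∣ q ^ 2)) → d ∣ l ^ r ℕ.* q
d∣lʳq l k r q d r≤k lᵏ⁻ʳ≡dq (inj₁ k≤2r) = divides (l ^ (r ∸ e) ℕ.* q ℕ.* q) (begin
  l ^ r ℕ.* q                   ≡⟨ cong (λ z → l ^ z ℕ.* q) (ℕP.m∸n+n≡m e≤r) ⟨
  l ^ (r ∸ e ℕ.+ e) ℕ.* q       ≡⟨ cong (ℕ._* q) (ℕP.^-distribˡ-+-* l (r ∸ e) e) ⟩
  l ^ (r ∸ e) ℕ.* l ^ e ℕ.* q   ≡⟨ cong (λ z → l ^ (r ∸ e) ℕ.* z ℕ.* q) lᵏ⁻ʳ≡dq ⟩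
  l ^ (r ∸ e) ℕ.* (d ℕ.* q) ℕ.* q ≡⟨ reorder (l ^ (r ∸ e)) d q ⟩
  l ^ (r ∸ e) ℕ.* q ℕ.* q ℕ.* d ∎)
  where
  open ≡-Reasoning
  e = k ∸ r
  e≤r : e ≤ r
  e≤r = subst (e ≤_) (ℕP.+-identityʳ r) (ℕP.m≤n+o⇒m∸n≤o k r k≤2r)
  reorder : ∀ x d q → x ℕ.* (d ℕ.* q) ℕ.* q ≡ x ℕ.* q ℕ.* q ℕ.* d
  reorder = NS.solve-∀
d∣lʳq l k r q d r≤k lᵏ⁻ʳ≡dq (inj₂ (2r<k , divides c q²≡cl)) = divides c
  (ℕP.*-cancelˡ-≡ (l ^ r ℕ.* q) (c ℕ.* d) (l ^ j) {{ℕP.m^n≢0 l j}} (begin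
    l ^ j ℕ.* (l ^ r ℕ.* q)       ≡⟨ ℕP.*-assoc (l ^ j) (l ^ r) q ⟨
    l ^ j ℕ.* l ^ r ℕ.* q         ≡⟨ cong (ℕ._* q) (ℕP.^-distribˡ-+-* l j r) ⟨
    l ^ (j ℕ.+ r) ℕ.* q           ≡⟨ cong (λ z → l ^ z ℕ.* q) (k∸2r+r≡k∸r k r (ℕP.<⇒≤ 2r<k)) ⟩
    l ^ (k ∸ r) ℕ.* q             ≡⟨ cong (ℕ._* q) lᵏ⁻ʳ≡dq ⟩
    d ℕ.* q ℕ.* q                 ≡⟨ square d q ⟩
    d ℕ.* q ^ 2                   ≡⟨ cong (d ℕ.*_) q²≡cl ⟩
    d ℕ.* (c ℕ.* l ^ j)           ≡⟨ swap d c (l ^ j) ⟩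
    l ^ j ℕ.* (c ℕ.* d)           ∎))
  where
  open ≡-Reasoning
  j = k ∸ 2 ℕ.* r
  square : ∀ d q → d ℕ.* q ℕ.* q ≡ d ℕ.* (q ℕ.* (q ℕ.* 1))
  square = NS.solve-∀
  swap : ∀ d c x → d ℕ.* (c ℕ.* x) ≡ x ℕ.* (c ℕ.* d)
  swap = NS.solve-∀

[lʳq]²≡l²ʳq² : ∀ l r q → l ^ r ℕ.* q ℕ.* (l ^ r ℕ.* q) ≡ l ^ (2 ℕ.* r) ℕ.* q ^ 2
[lʳq]²≡l²ʳq² l r q = begin
  l ^ r ℕ.* q ℕ.* (l ^ r ℕ.* q)     ≡⟨ regroup (l ^ r) q ⟩
  l ^ r ℕ.* l ^ r ℕ.* q ^ 2         ≡⟨ cong (ℕ._* q ^ 2) (ℕP.^-distribˡ-+-* l r r) ⟨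
  l ^ (r ℕ.+ r) ℕ.* q ^ 2           ≡⟨ cong (λ z → l ^ (r ℕ.+ z) ℕ.* q ^ 2) (ℕP.+-identityʳ r) ⟨
  l ^ (2 ℕ.* r) ℕ.* q ^ 2           ∎
  where
  open ≡-Reasoning
  regroup : ∀ x q → x ℕ.* q ℕ.* (x ℕ.* q) ≡ x ℕ.* x ℕ.* (q ℕ.* (q ℕ.* 1))
  regroup = NS.solve-∀

corollary1 : (l k r q : ℕ) → 0 < l → 0 < k → 0 < r → 0 < q → r ≤ k →
    q ∣ l ^ (k ∸ r) → ¬ (l ∣ q) →
    (k ≤ 2 ℕ.* r ⊎ (2 ℕ.* r < k × l ^ (k ∸ 2 ℕ.* r) ∣ q ^ 2)) →
    (ε : ℤ) → (ε ≡ + 1 ⊎ ε ≡ - (+ 1)) →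
    (m : ℤ) → (d : ℕ) → l ^ (k ∸ r) ≡ d ℕ.* q → gcd ∣ m ∣ d ≡ 1 →
    S (ε ℤ.+ + (l ^ r ℕ.* q) ℤ.* m) (l ^ k)
      ≡ (ε // 1) ℚ.* (((+ 2) // (l ^ k)) ℚ.+ ((+ (l ^ (2 ℕ.* r) ℕ.* q ^ 2)) // (l ^ k)) ℚ.- ((+ 3) // 1))
corollary1 l k r q 0<l _ _ _ r≤k _ _ _ ε ε≡±1 m zero lᵏ⁻ʳ≡0 _ =
  ⊥-elim (ℕ.≢-nonZero⁻¹ (l ^ (k ∸ r)) {{ℕP.m^n≢0 l (k ∸ r) {{ℕ.>-nonZero 0<l}}}} lᵏ⁻ʳ≡0)
corollary1 l k r q 0<l _ _ _ r≤k _ _ d∣a-cases ε ε≡±1 m d@(suc _) lᵏ⁻ʳ≡dq gcd≡1 =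
  subst (λ N → S (ε + + a * m) N ≡ rhs N (l ^ (2 ℕ.* r) ℕ.* q ^ 2)) 1+n≡lᵏ (begin
    S (ε + + a * m) (suc n)                 ≡⟨ S[ε+am]≡ n a d 1+n≡ad d∣a ε m ε≡±1 gcd≡1 ⟩
    rhs (suc n) (a ℕ.* a)                   ≡⟨ cong (rhs (suc n)) ([lʳq]²≡l²ʳq² l r q) ⟩
    rhs (suc n) (l ^ (2 ℕ.* r) ℕ.* q ^ 2)   ∎)
  where
  open ≡-Reasoning
  instance
    l≢0 : NonZero l
    l≢0 = ℕ.>-nonZero 0<l
  a = l ^ r ℕ.* q
  rhs : ℕ → ℕ → ℚ
  rhs N A = (ε // 1) ℚ.* (((+ 2) // N) ℚ.+ ((+ A) // N) ℚ.- ((+ 3) // 1))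
  n = ℕ.pred (l ^ k)
  1+n≡lᵏ : suc n ≡ l ^ k
  1+n≡lᵏ = ℕP.suc-pred (l ^ k) {{ℕP.m^n≢0 l k}}
  1+n≡ad : suc n ≡ a ℕ.* d
  1+n≡ad = trans 1+n≡lᵏ (lᵏ≡lʳq*d l k r q d r≤k lᵏ⁻ʳ≡dq)
  d∣a : d ∣ a
  d∣a = d∣lʳq l k r q d r≤k lᵏ⁻ʳ≡dq d∣a-cases
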